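{- For every natural number $k$ (including $k=0$), $St(k+5,k)=(k+1)(3k+77)$.
   Context: A strong fixed point of a permutation $\pi$ of $[n]$ is an element $k$ such that $\pi^{ -1}(j)<\pi^{ -1}(k)$ for all $j<k$ and $\pi^{ -1}(i)>\pi^{ -1}(k)$ for all $i>k$. $St(n,k)$ denotes the number of permutations of $[n]$ with exactly $k$ strong fixed points. -}

module Defs where

open import Data.Nat using (ℕ; zero; suc)
open import Data.Fin using (Fin; _<_; _≟_)
open import Data.Fin.Properties using (all?) renaming (_<?_ to _<ᶠ?_)
open import Data.Vec using (Vec; []; _∷_; lookup)
open import Data.List using (List; []; _∷_; concatMap; map; filter; length; allFin)
open import Data.Product using (_×_)
open import Relation.Binary.PropositionalEquality using (_≡_)
open import Relation.Nullary using (Dec; yes; no; _×-dec_; _→-dec_)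
import Data.Nat as ℕ

-- A permutation π of [n] = {0,…,n-1} (0-indexed Fin n) in one-line notation:
-- a word w with  lookup w i = π(i), required to be injective (hence bijective).

words : (n m : ℕ) → List (Vec (Fin n) m)
words n zero    = [] ∷ []
words n (suc m) = concatMap (λ x → map (x ∷_) (words n m)) (allFin n)

IsPerm : {n : ℕ} → Vec (Fin n) n → Set
IsPerm {n} w = (p q : Fin n) → lookup w p ≡ lookup w q → p ≡ q

isPerm? : {n : ℕ} → (w : Vec (Fin n) n) → Dec (IsPerm w)
isPerm? w = all? (λ p → all? (λ q → (lookup w p ≟ lookup w q) →-dec (p ≟ q)))

perms : (n : ℕ) → List (Vec (Fin n) n)
perms n = filter isPerm? (words n n)

StrongFixed : {n : ℕ} → Vec (Fin n) n → Fin n → Set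
StrongFixed {n} w k =
  (q : Fin n) → lookup w q ≡ k →
  (p : Fin n) → ((lookup w p < k → p < q) × (k < lookup w p → q < p))

strongFixed? : {n : ℕ} → (w : Vec (Fin n) n) → (k : Fin n) → Dec (StrongFixed w k)
strongFixed? w k =
  all? (λ q → (lookup w q ≟ k) →-dec
    all? (λ p → ((lookup w p <ᶠ? k) →-dec (p <ᶠ? _)) ×-dec ((k <ᶠ? lookup w p) →-dec (_ <ᶠ? p))))

numStrong : {n : ℕ} → Vec (Fin n) n → ℕ
numStrong w = length (filter (strongFixed? w) (allFin _))

St : ℕ → ℕ → ℕ
St n k = length (filter (λ w → numStrong w ℕ.≟ k) (perms n))

module Submission where

-- Write a permutation of [n] in one-line notation as a list l of naturals.
-- Position t is a *split* of l when l[t] = t and every earlier entry is < t;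
-- for a permutation, the value k is a strong fixed point exactly when the
-- position k is a split.  Cutting a permutation with a split at its FIRST
-- split q is a bijection
--     l  ↦  (α, β),   l = α ++ q ∷ (β shifted up by q+1),
-- onto pairs of a split-free permutation α of [q] and a permutation β of [r],
-- q + r = n, where β has one split fewer than l.  Hence the recurrence
--     St(n+1, j+1) = Σ_{q+r=n} St(q,0) · St(r,j).
-- Separately, any array S obeying the recurrence, vanishing below the
-- diagonal and with first column S(0..5, 0) = 1, 0, 1, 3, ·, 77 satisfies
-- S(k+5, k) = (k+1)(3k+77); the theorem follows since St(q,0) for q ≤ 5 is
-- computed by enumeration.

open import Defs
open import Data.Nat using (ℕ; zero; suc; _+_; _*_; _∸_; _≤_; _<_; z≤n; s≤s; s<s⁻¹; _⊔_; _≤?_; _<?_; _≟_)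
open import Data.Nat.Properties
open import Data.Nat.Tactic.RingSolver using (solve-∀)
open import Data.Bool using (true; false)
open import Data.Fin as F using (Fin; toℕ; fromℕ<)
import Data.Fin.Properties as FP
open import Data.Vec as V using (Vec; lookup)
import Data.Vec.Properties as VP
open import Data.List using (List; []; _∷_; _++_; length; map; filter; upTo; applyUpTo; allFin; cartesianProduct; take; tabulate)
open import Data.List.Properties
open import Data.List.Membership.Propositional using (_∈_)
open import Data.List.Membership.Propositional.Properties
import Data.List.Membership.DecPropositional as DecMembership
open import Data.List.Relation.Binary.Subset.Propositional using (_⊆_)
open import Data.List.Relation.Unary.Any as Any using (here; there)
open import Data.List.Relation.Unary.All as All using (All; []; _∷_)
import Data.List.Relation.Unary.All.Properties as AllP
open import Data.List.Relation.Unary.AllPairs as AllPairs using ([]; _∷_)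
import Data.List.Relation.Unary.AllPairs.Properties as AllPairsP
open import Data.List.Relation.Unary.Unique.Propositional using (Unique)
import Data.List.Relation.Unary.Unique.Propositional.Properties as UniqueP
open import Data.Product using (_×_; _,_; proj₁; proj₂; ∃)
open import Data.Sum using (inj₁; inj₂)
open import Data.Empty using (⊥; ⊥-elim)
open import Relation.Nullary using (Dec; yes; no; ¬_; _because_; _×-dec_)
open import Relation.Unary using (Pred; Decidable)
open import Relation.Binary.Definitions using (DecidableEquality; tri<; tri≈; tri>)
open import Relation.Binary.PropositionalEquality
open import Function using (_∘_; id)
import Level

module _ {A : Set} where

  unique-⊆⇒length≤ : ∀ {xs ys : List A} → Unique xs → xs ⊆ ys → length xs ≤ length ys
  unique-⊆⇒length≤ {[]} _ _ = z≤n
  unique-⊆⇒length≤ {x ∷ xs} (x∉xs ∷ uxs) xs⊆ys with ∈-∃++ (xs⊆ys (here refl))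
  ... | as , bs , refl =
    subst (suc (length xs) ≤_) (sym length-with-x) (s≤s (unique-⊆⇒length≤ uxs xs⊆as++bs))
    where
      length-with-x : length (as ++ x ∷ bs) ≡ suc (length (as ++ bs))
      length-with-x = begin
        length (as ++ x ∷ bs)        ≡⟨ length-++ as ⟩
        length as + suc (length bs)  ≡⟨ +-suc (length as) (length bs) ⟩
        suc (length as + length bs)  ≡⟨ cong suc (sym (length-++ as)) ⟩
        suc (length (as ++ bs))      ∎
        where open ≡-Reasoning
      xs⊆as++bs : xs ⊆ as ++ bs
      xs⊆as++bs {y} y∈xs with ∈-++⁻ as (xs⊆ys (there y∈xs))
      ... | inj₁ y∈as         = ∈-++⁺ˡ y∈as
      ... | inj₂ (here y≡x)   = ⊥-elim (All.lookup x∉xs y∈xs (sym y≡x))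
      ... | inj₂ (there y∈bs) = ∈-++⁺ʳ as y∈bs

  unique-⊆-length≥⇒⊇ : DecidableEquality A → ∀ {xs ys : List A} → Unique xs → xs ⊆ ys →
                       length ys ≤ length xs → ys ⊆ xs
  unique-⊆-length≥⇒⊇ _≟ᴬ_ {xs} uxs xs⊆ys |ys|≤|xs| {y} y∈ys with DecMembership._∈?_ _≟ᴬ_ y xs
  ... | yes y∈xs = y∈xs
  ... | no  y∉xs = ⊥-elim (1+n≰n (≤-trans (unique-⊆⇒length≤ (y∉ ∷ uxs) y∷xs⊆ys) |ys|≤|xs|))
    where
      y∉ = AllP.¬Any⇒All¬ xs y∉xs
      y∷xs⊆ys : y ∷ xs ⊆ _
      y∷xs⊆ys (here refl)  = y∈ys
      y∷xs⊆ys (there y∈xs) = xs⊆ys y∈xs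

  same-members⇒same-length : ∀ {xs ys : List A} → Unique xs → Unique ys →
                             xs ⊆ ys → ys ⊆ xs → length xs ≡ length ys
  same-members⇒same-length uxs uys xs⊆ys ys⊆xs =
    ≤-antisym (unique-⊆⇒length≤ uxs xs⊆ys) (unique-⊆⇒length≤ uys ys⊆xs)

  no-members⇒length≡0 : ∀ (xs : List A) → (∀ {x} → x ∈ xs → ⊥) → length xs ≡ 0
  no-members⇒length≡0 []       _     = refl
  no-members⇒length≡0 (x ∷ xs) empty = ⊥-elim (empty (here refl))

  map-unique : ∀ {B : Set} (f : A → B) {xs : List A} → Unique xs →
               (∀ {x y} → x ∈ xs → y ∈ xs → f x ≡ f y → x ≡ y) → Unique (map f xs)
  map-unique f []              _   = []
  map-unique f {x ∷ xs} (x∉ ∷ uxs) inj =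
    AllP.map⁺ (All.tabulate (λ y∈ fx≡fy → All.lookup x∉ y∈ (inj (here refl) (there y∈) fx≡fy))) ∷
    map-unique f uxs (λ p q → inj (there p) (there q))

  unique-++⁻ : ∀ (xs : List A) {ys} → Unique (xs ++ ys) →
               Unique xs × Unique ys × (∀ {v} → v ∈ xs → v ∈ ys → ⊥)
  unique-++⁻ []       u           = [] , u , λ ()
  unique-++⁻ (x ∷ xs) (x∉ ∷ uxs) with unique-++⁻ xs uxs
  ... | uxs′ , uys , disjoint =
    (AllP.++⁻ˡ xs x∉ ∷ uxs′) , uys ,
    λ { (here refl) v∈ys → All.lookup (AllP.++⁻ʳ xs x∉) v∈ys refl
      ; (there v∈xs) v∈ys → disjoint v∈xs v∈ys }

  ++-injective : ∀ (xs xs′ : List A) {ys ys′} → length xs ≡ length xs′ →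
                 xs ++ ys ≡ xs′ ++ ys′ → xs ≡ xs′ × ys ≡ ys′
  ++-injective []       []         _   e = refl , e
  ++-injective (x ∷ xs) (x′ ∷ xs′) len e with ++-injective xs xs′ (suc-injective len) (∷-injectiveʳ e)
  ... | xs≡ , ys≡ = cong₂ _∷_ (∷-injectiveˡ e) xs≡ , ys≡

length-cartesianProduct : ∀ {A B : Set} (xs : List A) (ys : List B) →
                          length (cartesianProduct xs ys) ≡ length xs * length ys
length-cartesianProduct []       ys = refl
length-cartesianProduct (x ∷ xs) ys =
  trans (length-++ (map (x ,_) ys)) (cong₂ _+_ (length-map (x ,_) ys) (length-cartesianProduct xs ys))

indicator : ∀ {A : Set} → Dec A → ℕ
indicator (true  because _) = 1
indicator (false because _) = 0

indicator-cong : ∀ {A B : Set} → (A → B) → (B → A) → (a : Dec A) (b : Dec B) → indicator a ≡ indicator b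
indicator-cong _ _ (yes _) (yes _) = refl
indicator-cong _ _ (no _)  (no _)  = refl
indicator-cong f _ (yes a) (no ¬b) = ⊥-elim (¬b (f a))
indicator-cong _ g (no ¬a) (yes b) = ⊥-elim (¬a (g b))

indicator-yes : ∀ {A : Set} → A → (d : Dec A) → indicator d ≡ 1
indicator-yes _ (yes _) = refl
indicator-yes a (no ¬a) = ⊥-elim (¬a a)

indicator-no : ∀ {A : Set} → ¬ A → (d : Dec A) → indicator d ≡ 0
indicator-no ¬a (yes a) = ⊥-elim (¬a a)
indicator-no _  (no _)  = refl

length-filter-∷ : ∀ {A : Set} {P : Pred A Level.zero} (P? : Decidable P) x xs →
                  length (filter P? (x ∷ xs)) ≡ indicator (P? x) + length (filter P? xs)
length-filter-∷ P? x xs with P? x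
... | yes _ = refl
... | no  _ = refl

count-map : ∀ {A B : Set} {P : Pred A Level.zero} {Q : Pred B Level.zero}
            (P? : Decidable P) (Q? : Decidable Q) (f : A → B) (xs : List A) →
            All (λ x → (P x → Q (f x)) × (Q (f x) → P x)) xs →
            length (filter P? xs) ≡ length (filter Q? (map f xs))
count-map P? Q? f []       []                 = refl
count-map P? Q? f (x ∷ xs) ((P⇒Q , Q⇒P) ∷ eqv) with P? x | Q? (f x)
... | yes _ | yes _  = cong suc (count-map P? Q? f xs eqv)
... | no _  | no _   = count-map P? Q? f xs eqv
... | yes p | no ¬q  = ⊥-elim (¬q (P⇒Q p))
... | no ¬p | yes q  = ⊥-elim (¬p (Q⇒P q))

-- Total list indexing: positions are naturals, out-of-range positions read 0.
infixl 9 _!_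
_!_ : List ℕ → ℕ → ℕ
[]       ! _     = 0
(x ∷ xs) ! zero  = x
(x ∷ xs) ! suc i = xs ! i

!-∈ : ∀ l {p} → p < length l → l ! p ∈ l
!-∈ (x ∷ xs) {zero}  _         = here refl
!-∈ (x ∷ xs) {suc p} (s≤s p<) = there (!-∈ xs p<)

∈⇒position : ∀ {l x} → x ∈ l → ∃ λ p → p < length l × l ! p ≡ x
∈⇒position (here x≡) = 0 , s≤s z≤n , sym x≡
∈⇒position (there x∈) with ∈⇒position x∈
... | p , p< , l!p≡x = suc p , s≤s p< , l!p≡x

PositionInjective : List ℕ → Set
PositionInjective l = ∀ p q → p < length l → q < length l → l ! p ≡ l ! q → p ≡ q

unique⇒positionInjective : ∀ {l} → Unique l → PositionInjective l
unique⇒positionInjective {x ∷ xs} _           zero    zero    _        _        _ = refl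
unique⇒positionInjective {x ∷ xs} (x∉ ∷ _)    zero    (suc q) _        (s≤s q<) e = ⊥-elim (All.lookup x∉ (!-∈ xs q<) e)
unique⇒positionInjective {x ∷ xs} (x∉ ∷ _)    (suc p) zero    (s≤s p<) _        e = ⊥-elim (All.lookup x∉ (!-∈ xs p<) (sym e))
unique⇒positionInjective          (_ ∷ uxs)   (suc p) (suc q) (s≤s p<) (s≤s q<) e =
  cong suc (unique⇒positionInjective uxs p q p< q< e)

positionInjective⇒unique : ∀ {l} → PositionInjective l → Unique l
positionInjective⇒unique {[]}     _   = []
positionInjective⇒unique {x ∷ xs} inj =
  All.tabulate (λ y∈ x≡y → let (p , p< , xs!p≡y) = ∈⇒position y∈ in
                  0≢1+n (inj 0 (suc p) (s≤s z≤n) (s≤s p<) (trans x≡y (sym xs!p≡y)))) ∷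
  positionInjective⇒unique (λ p q p< q< e → suc-injective (inj (suc p) (suc q) (s≤s p<) (s≤s q<) e))

IsPermList : ℕ → List ℕ → Set
IsPermList n l = length l ≡ n × All (_< n) l × Unique l

isPermList-surjective : ∀ {n l v} → IsPermList n l → v < n → v ∈ l
isPermList-surjective {n} (len , l<n , ul) v<n =
  unique-⊆-length≥⇒⊇ _≟_ ul (λ x∈ → ∈-upTo⁺ (All.lookup l<n x∈))
    (≤-reflexive (trans (length-upTo n) (sym len))) (∈-upTo⁺ v<n)

toNatList : ∀ {n m} → Vec (Fin n) m → List ℕ
toNatList V.[]       = []
toNatList (x V.∷ xs) = toℕ x ∷ toNatList xs

toNatList-length : ∀ {n m} (w : Vec (Fin n) m) → length (toNatList w) ≡ m
toNatList-length V.[]      = refl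
toNatList-length (_ V.∷ w) = cong suc (toNatList-length w)

toNatList-! : ∀ {n m} (w : Vec (Fin n) m) i → toNatList w ! toℕ i ≡ toℕ (lookup w i)
toNatList-! (_ V.∷ w) F.zero    = refl
toNatList-! (_ V.∷ w) (F.suc i) = toNatList-! w i

toNatList-injective : ∀ {n m} {w w′ : Vec (Fin n) m} → toNatList w ≡ toNatList w′ → w ≡ w′
toNatList-injective {w = V.[]}    {V.[]}     _ = refl
toNatList-injective {w = _ V.∷ _} {_ V.∷ _} e =
  cong₂ V._∷_ (FP.toℕ-injective (∷-injectiveˡ e)) (toNatList-injective (∷-injectiveʳ e))

toNatList-bounded : ∀ {n m} (w : Vec (Fin n) m) → All (_< n) (toNatList w)
toNatList-bounded V.[]      = []
toNatList-bounded (x V.∷ w) = FP.toℕ<n x ∷ toNatList-bounded w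

positionAt : ∀ {n} (w : Vec (Fin n) n) {p} → p < length (toNatList w) → Fin n
positionAt w p< = fromℕ< (subst (_ <_) (toNatList-length w) p<)

toℕ-positionAt : ∀ {n} (w : Vec (Fin n) n) {p} (p< : p < length (toNatList w)) → toℕ (positionAt w p<) ≡ p
toℕ-positionAt w p< = FP.toℕ-fromℕ< _

lookup-positionAt : ∀ {n} (w : Vec (Fin n) n) {p} (p< : p < length (toNatList w)) →
                    toℕ (lookup w (positionAt w p<)) ≡ toNatList w ! p
lookup-positionAt w p< =
  trans (sym (toNatList-! w (positionAt w p<))) (cong (toNatList w !_) (toℕ-positionAt w p<))

index-in-range : ∀ {n} (w : Vec (Fin n) n) (i : Fin n) → toℕ i < length (toNatList w)
index-in-range w i = subst (toℕ i <_) (sym (toNatList-length w)) (FP.toℕ<n i)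

isPerm⇒positionInjective : ∀ {n} (w : Vec (Fin n) n) → IsPerm w → PositionInjective (toNatList w)
isPerm⇒positionInjective w isPerm p q p< q< e =
  trans (sym (toℕ-positionAt w p<)) (trans (cong toℕ same-index) (toℕ-positionAt w q<))
  where
    same-index : positionAt w p< ≡ positionAt w q<
    same-index = isPerm _ _ (FP.toℕ-injective
      (trans (lookup-positionAt w p<) (trans e (sym (lookup-positionAt w q<)))))

positionInjective⇒isPerm : ∀ {n} (w : Vec (Fin n) n) → PositionInjective (toNatList w) → IsPerm w
positionInjective⇒isPerm w inj p q e = FP.toℕ-injective
  (inj (toℕ p) (toℕ q) (index-in-range w p) (index-in-range w q)
       (trans (toNatList-! w p) (trans (cong toℕ e) (sym (toNatList-! w q)))))

fromNatList : ∀ {n} (l : List ℕ) → All (_< n) l → Vec (Fin n) (length l)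
fromNatList []      []          = V.[]
fromNatList (_ ∷ l) (x< ∷ l<)   = fromℕ< x< V.∷ fromNatList l l<

toNatList-fromNatList : ∀ {n} (l : List ℕ) (l< : All (_< n) l) → toNatList (fromNatList l l<) ≡ l
toNatList-fromNatList []      []        = refl
toNatList-fromNatList (_ ∷ l) (x< ∷ l<) = cong₂ _∷_ (FP.toℕ-fromℕ< x<) (toNatList-fromNatList l l<)

toNatList-subst : ∀ {n m m′} (e : m ≡ m′) (w : Vec (Fin n) m) → toNatList (subst (Vec (Fin n)) e w) ≡ toNatList w
toNatList-subst refl w = refl

words-complete : ∀ n m (w : Vec (Fin n) m) → w ∈ words n m
words-complete n zero    V.[]       = here refl
words-complete n (suc m) (x V.∷ w) =
  ∈-concatMap⁺ (λ y → map (y V.∷_) (words n m))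
    (Any.map (λ { refl → ∈-map⁺ (x V.∷_) (words-complete n m w) }) (∈-allFin x))

words-unique : ∀ n m → Unique (words n m)
words-unique n zero    = [] ∷ []
words-unique n (suc m) =
  UniqueP.concat⁺ (AllP.map⁺ (All.tabulate (λ _ → UniqueP.map⁺ VP.∷-injectiveʳ (words-unique n m))))
                  (AllPairsP.map⁺ (AllPairs.map disjoint (UniqueP.allFin⁺ n)))
  where
    disjoint : ∀ {x y : Fin n} → x ≢ y → ∀ {v} → ¬ (v ∈ map (x V.∷_) (words n m) × v ∈ map (y V.∷_) (words n m))
    disjoint x≢y (v∈x , v∈y) with ∈-map⁻ _ v∈x | ∈-map⁻ _ v∈y
    ... | _ , _ , refl | _ , _ , e = x≢y (VP.∷-injectiveˡ e)

∈perms⇒isPerm : ∀ {n} {w : Vec (Fin n) n} → w ∈ perms n → IsPerm w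
∈perms⇒isPerm {n} w∈ = proj₂ (∈-filter⁻ isPerm? {xs = words n n} w∈)

permLists : ℕ → List (List ℕ)
permLists n = map toNatList (perms n)

permLists-unique : ∀ n → Unique (permLists n)
permLists-unique n = UniqueP.map⁺ toNatList-injective (UniqueP.filter⁺ isPerm? (words-unique n n))

∈permLists⇒isPermList : ∀ {n l} → l ∈ permLists n → IsPermList n l
∈permLists⇒isPermList l∈ with ∈-map⁻ toNatList l∈
... | w , w∈ , refl = toNatList-length w , toNatList-bounded w ,
                      positionInjective⇒unique (isPerm⇒positionInjective w (∈perms⇒isPerm w∈))

isPermList⇒∈permLists : ∀ {n l} → IsPermList n l → l ∈ permLists n
isPermList⇒∈permLists {n} {l} (len , l<n , ul) = subst (_∈ permLists n) w↦l
  (∈-map⁺ toNatList (∈-filter⁺ isPerm? (words-complete n n w)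
     (positionInjective⇒isPerm w (subst PositionInjective (sym w↦l) (unique⇒positionInjective ul)))))
  where
    w = subst (Vec (Fin n)) len (fromNatList l l<n)
    w↦l : toNatList w ≡ l
    w↦l = trans (toNatList-subst len (fromNatList l l<n)) (toNatList-fromNatList l l<n)

-- A list l is read as occupying positions i, i+1, …, and m is a strict upper
-- bound for the values met before position i.  Entry x at position i is a
-- split when x = i and m ≤ i, i.e. every earlier value is below i.

isSplit? : (i m x : ℕ) → Dec (x ≡ i × m ≤ i)
isSplit? i m x = (x ≟ i) ×-dec (m ≤? i)

bound : ℕ → List ℕ → ℕ
bound m []       = m
bound m (x ∷ xs) = bound (m ⊔ suc x) xs

splits : ℕ → ℕ → List ℕ → ℕ
splits i m []       = 0
splits i m (x ∷ xs) = indicator (isSplit? i m x) + splits (suc i) (m ⊔ suc x) xs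

-- Position of the first split of l (i + length l if there is none).
firstSplit : ℕ → ℕ → List ℕ → ℕ
firstSplit i m []       = i
firstSplit i m (x ∷ xs) with isSplit? i m x
... | yes _ = i
... | no  _ = firstSplit (suc i) (m ⊔ suc x) xs

bound-≤ : ∀ {b} m xs → All (_< b) xs → m ≤ b → bound m xs ≤ b
bound-≤ m []       []          m≤b = m≤b
bound-≤ m (x ∷ xs) (x<b ∷ xs<b) m≤b = bound-≤ (m ⊔ suc x) xs xs<b (⊔-lub m≤b x<b)

≤-bound : ∀ m xs → m ≤ bound m xs
≤-bound m []       = ≤-refl
≤-bound m (x ∷ xs) = ≤-trans (m≤m⊔n m (suc x)) (≤-bound (m ⊔ suc x) xs)

bound-≤⇒All : ∀ {b} m xs → bound m xs ≤ b → All (_< b) xs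
bound-≤⇒All m []       _   = []
bound-≤⇒All m (x ∷ xs) ≤b =
  m⊔n≤o⇒n≤o m (suc x) (≤-trans (≤-bound (m ⊔ suc x) xs) ≤b) ∷ bound-≤⇒All (m ⊔ suc x) xs ≤b

splits≤length : ∀ i m xs → splits i m xs ≤ length xs
splits≤length i m []       = z≤n
splits≤length i m (x ∷ xs) with isSplit? i m x
... | yes _ = s≤s (splits≤length (suc i) (m ⊔ suc x) xs)
... | no  _ = m≤n⇒m≤1+n (splits≤length (suc i) (m ⊔ suc x) xs)

splits-shift : ∀ c i m xs → splits (c + i) (c + m) (map (c +_) xs) ≡ splits i m xs
splits-shift c i m []       = refl
splits-shift c i m (x ∷ xs) = cong₂ _+_ same-head same-tail
  where
    same-head : indicator (isSplit? (c + i) (c + m) (c + x)) ≡ indicator (isSplit? i m x)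
    same-head = indicator-cong (λ (e , le) → +-cancelˡ-≡ c _ _ e , +-cancelˡ-≤ c _ _ le)
                               (λ (e , le) → cong (c +_) e , +-monoʳ-≤ c le) _ _
    next-bound : c + m ⊔ suc (c + x) ≡ c + (m ⊔ suc x)
    next-bound = trans (cong (c + m ⊔_) (sym (+-suc c x))) (sym (+-distribˡ-⊔ c m (suc x)))
    same-tail : splits (suc (c + i)) (c + m ⊔ suc (c + x)) (map (c +_) xs) ≡ splits (suc i) (m ⊔ suc x) xs
    same-tail = trans (cong₂ (λ i′ m′ → splits i′ m′ (map (c +_) xs)) (sym (+-suc c i)) next-bound)
                      (splits-shift c (suc i) (m ⊔ suc x) xs)

splits-shift₀ : ∀ c xs → splits c c (map (c +_) xs) ≡ splits 0 0 xs
splits-shift₀ c xs =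
  trans (cong₂ (λ i m → splits i m (map (c +_) xs)) (sym (+-identityʳ c)) (sym (+-identityʳ c)))
        (splits-shift c 0 0 xs)

splits-++ : ∀ i m xs ys → splits i m (xs ++ ys) ≡ splits i m xs + splits (i + length xs) (bound m xs) ys
splits-++ i m []       ys = cong (λ i′ → splits i′ m ys) (sym (+-identityʳ i))
splits-++ i m (x ∷ xs) ys = begin
  h + splits (suc i) m′ (xs ++ ys)                                      ≡⟨ cong (h +_) (splits-++ (suc i) m′ xs ys) ⟩
  h + (splits (suc i) m′ xs + splits (suc i + length xs) (bound m′ xs) ys) ≡⟨ sym (+-assoc h _ _) ⟩
  h + splits (suc i) m′ xs + splits (suc i + length xs) (bound m′ xs) ys   ≡⟨ cong (λ i′ → h + splits (suc i) m′ xs + splits i′ (bound m′ xs) ys) (sym (+-suc i (length xs))) ⟩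
  h + splits (suc i) m′ xs + splits (i + suc (length xs)) (bound m′ xs) ys ∎
  where
    open ≡-Reasoning
    h  = indicator (isSplit? i m x)
    m′ = m ⊔ suc x

firstSplit-++ : ∀ i m xs ys → splits i m xs ≡ 0 → firstSplit i m (xs ++ ys) ≡ firstSplit (i + length xs) (bound m xs) ys
firstSplit-++ i m []       ys _ = cong (λ i′ → firstSplit i′ m ys) (sym (+-identityʳ i))
firstSplit-++ i m (x ∷ xs) ys none with isSplit? i m x
... | yes _ = ⊥-elim (0≢1+n (sym none))
... | no  _ = trans (firstSplit-++ (suc i) (m ⊔ suc x) xs ys none)
                    (cong (λ i′ → firstSplit i′ (bound (m ⊔ suc x) xs) ys) (sym (+-suc i (length xs))))

firstSplit-at-split : ∀ i m xs → m ≤ i → firstSplit i m (i ∷ xs) ≡ i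
firstSplit-at-split i m xs m≤i with isSplit? i m i
... | yes _     = refl
... | no ¬split = ⊥-elim (¬split (refl , m≤i))

splits-first : ∀ i m l j → splits i m l ≡ suc j →
  ∃ λ α → ∃ λ x → ∃ λ γ → l ≡ α ++ x ∷ γ × splits i m α ≡ 0 × x ≡ i + length α ×
                         bound m α ≤ x × splits (suc x) (suc x) γ ≡ j
splits-first i m []       j ()
splits-first i m (y ∷ ys) j e with isSplit? i m y
... | yes (refl , m≤y) =
  [] , y , ys , refl , refl , sym (+-identityʳ y) , m≤y ,
  trans (cong (λ m′ → splits (suc y) m′ ys) (sym (m≤n⇒m⊔n≡n (m≤n⇒m≤1+n m≤y)))) (suc-injective e)
... | no ¬split with splits-first (suc i) (m ⊔ suc y) ys j e
...   | α , x , γ , refl , none , x≡ , α<x , rest =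
  y ∷ α , x , γ , refl ,
  trans (cong (_+ splits (suc i) (m ⊔ suc y) α) (indicator-no ¬split (isSplit? i m y))) none ,
  trans x≡ (sym (+-suc i (length α))) , α<x , rest

IsSplitAt : ℕ → ℕ → List ℕ → ℕ → Set
IsSplitAt i m l t = l ! t ≡ i + t × m ≤ i + t × All (_< i + t) (take t l)

isSplitAt? : ∀ i m l → Decidable (IsSplitAt i m l)
isSplitAt? i m l t = (l ! t ≟ i + t) ×-dec (m ≤? i + t) ×-dec All.all? (_<? i + t) (take t l)

isSplitAt-suc : ∀ i m x xs t → (IsSplitAt (suc i) (m ⊔ suc x) xs t → IsSplitAt i m (x ∷ xs) (suc t)) ×
                                (IsSplitAt i m (x ∷ xs) (suc t) → IsSplitAt (suc i) (m ⊔ suc x) xs t)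
isSplitAt-suc i m x xs t rewrite +-suc i t =
  (λ (e , m′≤ , xs<) → e , m⊔n≤o⇒m≤o m (suc x) m′≤ , m⊔n≤o⇒n≤o m (suc x) m′≤ ∷ xs<) ,
  (λ { (e , m≤ , (x< ∷ xs<)) → e , ⊔-lub m≤ x< , xs< })

isSplitAt-zero : ∀ i m x xs → (IsSplitAt i m (x ∷ xs) 0 → x ≡ i × m ≤ i) × (x ≡ i × m ≤ i → IsSplitAt i m (x ∷ xs) 0)
isSplitAt-zero i m x xs =
  (λ (e , m≤ , _) → trans e (+-identityʳ i) , subst (m ≤_) (+-identityʳ i) m≤) ,
  (λ (e , m≤) → trans e (sym (+-identityʳ i)) , subst (m ≤_) (sym (+-identityʳ i)) m≤ , [])

splits-counts : ∀ i m l → length (filter (isSplitAt? i m l) (upTo (length l))) ≡ splits i m l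
splits-counts i m []       = refl
splits-counts i m (x ∷ xs) = begin
  length (filter P? (upTo (suc (length xs))))
    ≡⟨ length-filter-∷ P? 0 (applyUpTo suc (length xs)) ⟩
  indicator (P? 0) + length (filter P? (applyUpTo suc (length xs)))
    ≡⟨ cong₂ _+_ (indicator-cong (proj₁ zero-case) (proj₂ zero-case) _ _)
                 (cong (length ∘ filter P?) (sym (map-upTo suc (length xs)))) ⟩
  indicator (isSplit? i m x) + length (filter P? (map suc (upTo (length xs))))
    ≡⟨ cong (indicator (isSplit? i m x) +_) (sym (count-map (isSplitAt? (suc i) m′ xs) P? suc (upTo (length xs))
                                                   (All.tabulate (λ {t} _ → isSplitAt-suc i m x xs t)))) ⟩
  indicator (isSplit? i m x) + length (filter (isSplitAt? (suc i) m′ xs) (upTo (length xs)))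
    ≡⟨ cong (indicator (isSplit? i m x) +_) (splits-counts (suc i) m′ xs) ⟩
  splits i m (x ∷ xs) ∎
  where
    open ≡-Reasoning
    P? = isSplitAt? i m (x ∷ xs)
    m′ = m ⊔ suc x
    zero-case = isSplitAt-zero i m x xs

-- Strong fixed points are splits

ListStrongFixed : List ℕ → ℕ → Set
ListStrongFixed l k = ∀ q → q < length l → l ! q ≡ k → ∀ p → p < length l →
                      (l ! p < k → p < q) × (k < l ! p → q < p)

strongFixed⇒listStrongFixed : ∀ {n} (w : Vec (Fin n) n) k → StrongFixed w k → ListStrongFixed (toNatList w) (toℕ k)
strongFixed⇒listStrongFixed w k sf q q< l!q≡k p p< =
  (λ lt → subst₂ _<_ (toℕ-positionAt w p<) (toℕ-positionAt w q<)
                     (proj₁ condition (subst (_< toℕ k) (sym (lookup-positionAt w p<)) lt))) ,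
  (λ lt → subst₂ _<_ (toℕ-positionAt w q<) (toℕ-positionAt w p<)
                     (proj₂ condition (subst (toℕ k <_) (sym (lookup-positionAt w p<)) lt)))
  where
    condition = sf (positionAt w q<) (FP.toℕ-injective (trans (lookup-positionAt w q<) l!q≡k)) (positionAt w p<)

listStrongFixed⇒strongFixed : ∀ {n} (w : Vec (Fin n) n) k → ListStrongFixed (toNatList w) (toℕ k) → StrongFixed w k
listStrongFixed⇒strongFixed w k sf q wq≡k p =
  (λ lt → proj₁ condition (subst (_< toℕ k) (sym (toNatList-! w p)) lt)) ,
  (λ lt → proj₂ condition (subst (toℕ k <_) (sym (toNatList-! w p)) lt))
  where
    condition = sf (toℕ q) (index-in-range w q) (trans (toNatList-! w q) (cong toℕ wq≡k))
                   (toℕ p) (index-in-range w p)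

∈-take⇒position : ∀ q l {x} → x ∈ take q l → ∃ λ t → t < q × t < length l × l ! t ≡ x
∈-take⇒position (suc q) (y ∷ l) (here x≡y) = 0 , s≤s z≤n , s≤s z≤n , sym x≡y
∈-take⇒position (suc q) (y ∷ l) (there x∈) with ∈-take⇒position q l x∈
... | t , t<q , t<l , l!t≡x = suc t , s≤s t<q , s≤s t<l , l!t≡x

position-∈-take : ∀ q l t → t < q → t < length l → l ! t ∈ take q l
position-∈-take (suc q) (y ∷ l) zero    _         _         = here refl
position-∈-take (suc q) (y ∷ l) (suc t) (s≤s t<q) (s≤s t<l) = there (position-∈-take q l t t<q t<l)

length-take≤ : ∀ q (l : List ℕ) → q ≤ length l → length (take q l) ≡ q
length-take≤ q l q≤ = trans (length-take q l) (m≤n⇒m⊓n≡m q≤)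

module StrongFixedPoints {n l} (perm : IsPermList n l) where

  private
    len = proj₁ perm
    ul  = proj₂ (proj₂ perm)
    inj = unique⇒positionInjective ul

  split⇒strongFixed : ∀ k → k < n → IsSplitAt 0 0 l k → ListStrongFixed l k
  split⇒strongFixed k k<n (l!k≡k , _ , prefix<k) q q< l!q≡k p p< = smaller-before , larger-after
    where
      k<l = subst (k <_) (sym len) k<n
      q≡k : q ≡ k
      q≡k = inj q k q< k<l (trans l!q≡k (sym l!k≡k))
      -- the first k entries are k distinct values below k, hence all of [0,k)
      prefix-perm : IsPermList k (take k l)
      prefix-perm = length-take≤ k l (<⇒≤ k<l) , prefix<k , UniqueP.take⁺ k ul
      smaller-before : l ! p < k → p < q
      smaller-before lt with ∈-take⇒position k l (isPermList-surjective prefix-perm lt)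
      ... | t , t<k , t<l , l!t≡l!p = subst (_< q) (inj t p t<l p< l!t≡l!p) (subst (t <_) (sym q≡k) t<k)
      larger-after : k < l ! p → q < p
      larger-after lt with <-cmp p k
      ... | tri< p<k _ _   = ⊥-elim (<-asym lt (All.lookup prefix<k (position-∈-take k l p p<k p<)))
      ... | tri≈ _ refl _  = ⊥-elim (<-irrefl (sym l!k≡k) lt)
      ... | tri> _ _ k<p   = subst (_< p) (sym q≡k) k<p

  strongFixed⇒split : ∀ k → k < n → ListStrongFixed l k → IsSplitAt 0 0 l k
  strongFixed⇒split k k<n sf = subst (λ z → l ! z ≡ k) q≡k l!q≡k , z≤n , subst (λ z → All (_< k) (take z l)) q≡k prefix<k
    where
      position-of-k = ∈⇒position (isPermList-surjective perm k<n)
      q      = proj₁ position-of-k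
      q<     = proj₁ (proj₂ position-of-k)
      l!q≡k  = proj₂ (proj₂ position-of-k)
      condition = sf q q< l!q≡k
      prefix⊆smaller : take q l ⊆ upTo k
      prefix⊆smaller {x} x∈ with ∈-take⇒position q l x∈
      ... | t , t<q , t<l , l!t≡x with <-cmp x k
      ...   | tri< x<k _ _ = ∈-upTo⁺ x<k
      ...   | tri≈ _ x≡k _ = ⊥-elim (<-irrefl (inj t q t<l q< (trans l!t≡x (trans x≡k (sym l!q≡k)))) t<q)
      ...   | tri> _ _ k<x = ⊥-elim (<-asym t<q (proj₂ (condition t t<l) (subst (k <_) (sym l!t≡x) k<x)))
      smaller⊆prefix : upTo k ⊆ take q l
      smaller⊆prefix {v} v∈ with ∈⇒position (isPermList-surjective perm (<-trans (∈-upTo⁻ v∈) k<n))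
      ... | p , p< , l!p≡v = subst (_∈ take q l) l!p≡v
              (position-∈-take q l p (proj₁ (condition p p<) (subst (_< k) (sym l!p≡v) (∈-upTo⁻ v∈))) p<)
      prefix<k : All (_< k) (take q l)
      prefix<k = All.tabulate (λ x∈ → ∈-upTo⁻ (prefix⊆smaller x∈))
      |prefix| = length-take≤ q l (<⇒≤ q<)
      q≡k : q ≡ k
      q≡k = ≤-antisym (subst₂ _≤_ |prefix| (length-upTo k) (unique-⊆⇒length≤ (UniqueP.take⁺ q ul) prefix⊆smaller))
                      (subst₂ _≤_ (length-upTo k) |prefix| (unique-⊆⇒length≤ (UniqueP.upTo⁺ k) smaller⊆prefix))

map-toℕ-allFin : ∀ n → map toℕ (allFin n) ≡ upTo n
map-toℕ-allFin n = trans (map-tabulate id toℕ) (tabulate-toℕ n id)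
  where
    tabulate-toℕ : ∀ n (f : ℕ → ℕ) → tabulate {n = n} (f ∘ toℕ) ≡ applyUpTo f n
    tabulate-toℕ zero    f = refl
    tabulate-toℕ (suc n) f = cong (f 0 ∷_) (tabulate-toℕ n (f ∘ suc))

numStrong≡splits : ∀ {n} (w : Vec (Fin n) n) → IsPerm w → numStrong w ≡ splits 0 0 (toNatList w)
numStrong≡splits {n} w isPerm = begin
  length (filter (strongFixed? w) (allFin n))
    ≡⟨ count-map (strongFixed? w) split? toℕ (allFin n) (All.tabulate (λ {k} _ → same k)) ⟩
  length (filter split? (map toℕ (allFin n)))
    ≡⟨ cong (length ∘ filter split?) (trans (map-toℕ-allFin n) (cong upTo (sym (toNatList-length w)))) ⟩
  length (filter split? (upTo (length l)))
    ≡⟨ splits-counts 0 0 l ⟩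
  splits 0 0 l ∎
  where
    open ≡-Reasoning
    l = toNatList w
    split? = isSplitAt? 0 0 l
    open StrongFixedPoints (toNatList-length w , toNatList-bounded w ,
                            positionInjective⇒unique (isPerm⇒positionInjective w isPerm))
    same : ∀ k → (StrongFixed w k → IsSplitAt 0 0 l (toℕ k)) × (IsSplitAt 0 0 l (toℕ k) → StrongFixed w k)
    same k = (λ sf → strongFixed⇒split (toℕ k) (FP.toℕ<n k) (strongFixed⇒listStrongFixed w k sf)) ,
             (λ sp → listStrongFixed⇒strongFixed w k (split⇒strongFixed (toℕ k) (FP.toℕ<n k) sp))

PermsWith : ℕ → ℕ → List (List ℕ)
PermsWith n j = filter (λ l → splits 0 0 l ≟ j) (permLists n)

St≡length : ∀ n j → St n j ≡ length (PermsWith n j)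
St≡length n j = count-map (λ w → numStrong w ≟ j) (λ l → splits 0 0 l ≟ j) toNatList (perms n)
  (All.tabulate (λ {w} w∈ → let same = numStrong≡splits w (∈perms⇒isPerm w∈) in
                        (λ e → trans (sym same) e) , (λ e → trans same e)))

PermsWith-unique : ∀ n j → Unique (PermsWith n j)
PermsWith-unique n j = UniqueP.filter⁺ (λ l → splits 0 0 l ≟ j) (permLists-unique n)

∈PermsWith⇒ : ∀ n j {l} → l ∈ PermsWith n j → IsPermList n l × splits 0 0 l ≡ j
∈PermsWith⇒ n j l∈ with ∈-filter⁻ (λ l → splits 0 0 l ≟ j) {xs = permLists n} l∈
... | l∈perms , e = ∈permLists⇒isPermList l∈perms , e

⇒∈PermsWith : ∀ n j {l} → IsPermList n l → splits 0 0 l ≡ j → l ∈ PermsWith n j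
⇒∈PermsWith n j perm e = ∈-filter⁺ (λ l → splits 0 0 l ≟ j) (isPermList⇒∈permLists perm) e

St-vanishing : ∀ n j → n < j → St n j ≡ 0
St-vanishing n j n<j = trans (St≡length n j) (no-members⇒length≡0 (PermsWith n j) λ {l} l∈ →
  let ((len , _ , _) , e) = ∈PermsWith⇒ n j l∈ in
  <⇒≱ n<j (subst₂ _≤_ e len (splits≤length 0 0 l)))

-- Gluing at the first split

glue : List ℕ → ℕ → List ℕ → List ℕ
glue α q β = α ++ q ∷ map (suc q +_) β

length-glue : ∀ α q β → length (glue α q β) ≡ suc (length α + length β)
length-glue α q β =
  trans (length-++ α) (trans (+-suc (length α) _) (cong (λ z → suc (length α + z)) (length-map (suc q +_) β)))

glue-isPermList : ∀ {q r α β} → IsPermList q α → IsPermList r β → IsPermList (suc (q + r)) (glue α q β)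
glue-isPermList {q} {r} {α} {β} (refl , α<q , uα) (refl , β<r , uβ) = size , bounded , unique
  where
    shifted = map (suc q +_) β
    size : length (glue α q β) ≡ suc (q + r)
    size = length-glue α q β
    above-q : ∀ {v} → v ∈ shifted → suc q ≤ v
    above-q v∈ with ∈-map⁻ (suc q +_) v∈
    ... | b , _ , refl = m≤m+n (suc q) b
    bounded : All (_< suc (q + r)) (glue α q β)
    bounded = AllP.++⁺ (All.map (λ v<q → m≤n⇒m≤1+n (≤-trans v<q (m≤m+n q r))) α<q)
                       (s≤s (m≤m+n q r) ∷ AllP.map⁺ (All.map (λ b<r → s≤s (+-monoʳ-< q b<r)) β<r))
    at-least-q : ∀ {v} → v ∈ q ∷ shifted → q ≤ v
    at-least-q (here refl) = ≤-refl
    at-least-q (there v∈)  = <⇒≤ (above-q v∈)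
    unique : Unique (glue α q β)
    unique = UniqueP.++⁺ uα
               (All.tabulate (λ v∈ q≡v → 1+n≰n (subst (suc q ≤_) (sym q≡v) (above-q v∈))) ∷
                UniqueP.map⁺ (+-cancelˡ-≡ (suc q) _ _) uβ)
               (λ (v∈α , v∈rest) → <⇒≱ (All.lookup α<q v∈α) (at-least-q v∈rest))

glue-splits : ∀ {q α} β → IsPermList q α → splits 0 0 α ≡ 0 → splits 0 0 (glue α q β) ≡ suc (splits 0 0 β)
glue-splits {q} {α} β (refl , α<q , _) α-free = begin
  splits 0 0 (α ++ q ∷ map (suc q +_) β)                 ≡⟨ splits-++ 0 0 α _ ⟩
  splits 0 0 α + splits q M (q ∷ map (suc q +_) β)        ≡⟨ cong (_+ splits q M (q ∷ map (suc q +_) β)) α-free ⟩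
  indicator (isSplit? q M q) + splits (suc q) (M ⊔ suc q) (map (suc q +_) β)
    ≡⟨ cong₂ _+_ (indicator-yes (refl , M≤q) (isSplit? q M q))
                 (cong (λ m → splits (suc q) m (map (suc q +_) β)) (m≤n⇒m⊔n≡n (m≤n⇒m≤1+n M≤q))) ⟩
  suc (splits (suc q) (suc q) (map (suc q +_) β))         ≡⟨ cong suc (splits-shift₀ (suc q) β) ⟩
  suc (splits 0 0 β)                                      ∎
  where
    open ≡-Reasoning
    M = bound 0 α
    M≤q = bound-≤ 0 α α<q z≤n

firstSplit-glue : ∀ {q α} β → IsPermList q α → splits 0 0 α ≡ 0 → firstSplit 0 0 (glue α q β) ≡ q
firstSplit-glue {q} {α} β (refl , α<q , _) α-free =
  trans (firstSplit-++ 0 0 α (q ∷ map (suc q +_) β) α-free)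
        (firstSplit-at-split q (bound 0 α) (map (suc q +_) β) (bound-≤ 0 α α<q z≤n))

suffix-above : ∀ {q α γ} → IsPermList q α → Unique (α ++ q ∷ γ) → All (suc q ≤_) γ
suffix-above {q} {α} {γ} α-perm u = All.tabulate above
  where
    parts = unique-++⁻ α u
    above : ∀ {y} → y ∈ γ → suc q ≤ y
    above {y} y∈ with <-cmp y q | proj₁ (proj₂ parts)
    ... | tri< y<q _ _ | _          = ⊥-elim (proj₂ (proj₂ parts) (isPermList-surjective α-perm y<q) (there y∈))
    ... | tri≈ _ refl _ | (q∉ ∷ _)  = ⊥-elim (All.lookup q∉ y∈ refl)
    ... | tri> _ _ q<y | _          = q<y

prefix-isPermList : ∀ {α ys : List ℕ} → All (_< length α) α → Unique (α ++ ys) → IsPermList (length α) α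
prefix-isPermList α-below u = refl , α-below , proj₁ (unique-++⁻ _ u)

unshift : ∀ c (γ : List ℕ) → All (c ≤_) γ → ∃ λ β → γ ≡ map (c +_) β
unshift c []      []          = [] , refl
unshift c (y ∷ γ) (c≤y ∷ c≤γ) with unshift c γ c≤γ
... | β , γ≡ = (y ∸ c) ∷ β , cong₂ _∷_ (sym (m+[n∸m]≡n c≤y)) γ≡

decompose : ∀ {n j l} → IsPermList (suc n) l → splits 0 0 l ≡ suc j →
  ∃ λ q → ∃ λ r → ∃ λ α → ∃ λ β → q + r ≡ n × IsPermList q α × splits 0 0 α ≡ 0 ×
                                   IsPermList r β × splits 0 0 β ≡ j × l ≡ glue α q β
decompose {n} {j} {l} (len , l<n , ul) e with splits-first 0 0 l j e
... | α , .(length α) , γ , refl , α-free , refl , α-below , γ-splits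
  with β , refl ← unshift (suc (length α)) γ (suffix-above (prefix-isPermList (bound-≤⇒All 0 α α-below) ul) ul)
  = q , length β , α , β , sizes , prefix-isPermList (bound-≤⇒All 0 α α-below) ul , α-free , β-perm , β-splits , refl
  where
    q = length α
    sizes : q + length β ≡ n
    sizes = suc-injective (trans (sym (length-glue α q β)) len)
    rest : Unique (q ∷ map (suc q +_) β)
    rest = proj₁ (proj₂ (unique-++⁻ α ul))
    β-bounded : All (_< length β) β
    β-bounded = All.map (λ {b} sqb< → +-cancelˡ-< q b (length β) (s<s⁻¹ (subst (suc q + b <_) (cong suc (sym sizes)) sqb<)))
                        (AllP.map⁻ (All.tail (AllP.++⁻ʳ α l<n)))
    β-perm : IsPermList (length β) β
    β-perm = refl , β-bounded , UniqueP.map⁻ (AllPairs.tail rest)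
    β-splits : splits 0 0 β ≡ j
    β-splits = trans (sym (splits-shift₀ (suc q) β)) γ-splits

-- The convolution recurrence for St

convolutionFrom : (ℕ → ℕ) → (ℕ → ℕ) → ℕ → ℕ → ℕ
convolutionFrom a b c zero    = a c * b 0
convolutionFrom a b c (suc n) = a c * b (suc n) + convolutionFrom a b (suc c) n

glueAt : ℕ → List ℕ × List ℕ → List ℕ
glueAt q (α , β) = glue α q β

gluings : ℕ → ℕ → ℕ → List (List ℕ)
gluings q r j = map (glueAt q) (cartesianProduct (PermsWith q 0) (PermsWith r j))

length-gluings : ∀ q r j → length (gluings q r j) ≡ St q 0 * St r j
length-gluings q r j =
  trans (length-map (glueAt q) (cartesianProduct (PermsWith q 0) (PermsWith r j)))
        (trans (length-cartesianProduct (PermsWith q 0) (PermsWith r j))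
               (sym (cong₂ _*_ (St≡length q 0) (St≡length r j))))

∈gluings⇒ : ∀ q r j {l} → l ∈ gluings q r j →
            ∃ λ α → ∃ λ β → α ∈ PermsWith q 0 × β ∈ PermsWith r j × l ≡ glue α q β
∈gluings⇒ q r j l∈ with ∈-map⁻ (glueAt q) l∈
... | (α , β) , αβ∈ , refl with ∈-cartesianProduct⁻ (PermsWith q 0) (PermsWith r j) αβ∈
... | α∈ , β∈ = α , β , α∈ , β∈ , refl

glue-∈gluings : ∀ q r j {α β} → α ∈ PermsWith q 0 → β ∈ PermsWith r j → glue α q β ∈ gluings q r j
glue-∈gluings q r j α∈ β∈ = ∈-map⁺ (glueAt q) (∈-cartesianProduct⁺ α∈ β∈)

-- Different pairs glue to different lists: the heads have the same length q.
gluings-unique : ∀ q r j → Unique (gluings q r j)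
gluings-unique q r j =
  map-unique (glueAt q) (UniqueP.cartesianProduct⁺ (PermsWith-unique q 0) (PermsWith-unique r j)) injective
  where
    pairs = cartesianProduct (PermsWith q 0) (PermsWith r j)
    injective : ∀ {x y} → x ∈ pairs → y ∈ pairs → glueAt q x ≡ glueAt q y → x ≡ y
    injective {α , β} {α′ , β′} x∈ y∈ e
      with ∈-cartesianProduct⁻ (PermsWith q 0) (PermsWith r j) x∈
         | ∈-cartesianProduct⁻ (PermsWith q 0) (PermsWith r j) y∈
    ... | α∈ , _ | α′∈ , _
      with ++-injective α α′ (trans (proj₁ (proj₁ (∈PermsWith⇒ q 0 α∈))) (sym (proj₁ (proj₁ (∈PermsWith⇒ q 0 α′∈))))) e
    ... | refl , tails = cong (α ,_) (map-injective (λ {u} {v} → +-cancelˡ-≡ (suc q) u v) (∷-injectiveʳ tails))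

gluingsFrom : ℕ → ℕ → ℕ → List (List ℕ)
gluingsFrom c zero    j = gluings c 0 j
gluingsFrom c (suc n) j = gluings c (suc n) j ++ gluingsFrom (suc c) n j

length-gluingsFrom : ∀ c n j → length (gluingsFrom c n j) ≡ convolutionFrom (λ q → St q 0) (λ r → St r j) c n
length-gluingsFrom c zero    j = length-gluings c 0 j
length-gluingsFrom c (suc n) j =
  trans (length-++ (gluings c (suc n) j)) (cong₂ _+_ (length-gluings c (suc n) j) (length-gluingsFrom (suc c) n j))

∈gluingsFrom⇒ : ∀ c n j {l} → l ∈ gluingsFrom c n j → ∃ λ q → ∃ λ r → ∃ λ α → ∃ λ β →
                c ≤ q × q + r ≡ c + n × α ∈ PermsWith q 0 × β ∈ PermsWith r j × l ≡ glue α q β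
∈gluingsFrom⇒ c zero j l∈ with ∈gluings⇒ c 0 j l∈
... | α , β , α∈ , β∈ , l≡ = c , 0 , α , β , ≤-refl , refl , α∈ , β∈ , l≡
∈gluingsFrom⇒ c (suc n) j l∈ with ∈-++⁻ (gluings c (suc n) j) l∈
... | inj₁ here′  = let (α , β , α∈ , β∈ , l≡) = ∈gluings⇒ c (suc n) j here′ in
                    c , suc n , α , β , ≤-refl , refl , α∈ , β∈ , l≡
... | inj₂ later = let (q , r , α , β , c<q , sizes , α∈ , β∈ , l≡) = ∈gluingsFrom⇒ (suc c) n j later in
                   q , r , α , β , <⇒≤ c<q , trans sizes (sym (+-suc c n)) , α∈ , β∈ , l≡

glue-∈gluingsFrom : ∀ c n j {q r α β} → c ≤ q → q + r ≡ c + n →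
                    α ∈ PermsWith q 0 → β ∈ PermsWith r j → glue α q β ∈ gluingsFrom c n j
glue-∈gluingsFrom c n j {q} {r} c≤q sizes α∈ β∈ with m≤n⇒m<n∨m≡n c≤q
glue-∈gluingsFrom c zero    j {r = r} _ sizes α∈ β∈ | inj₂ refl with +-cancelˡ-≡ c r 0 sizes
... | refl = glue-∈gluings c 0 j α∈ β∈
glue-∈gluingsFrom c (suc n) j {r = r} _ sizes α∈ β∈ | inj₂ refl with +-cancelˡ-≡ c r (suc n) sizes
... | refl = ∈-++⁺ˡ (glue-∈gluings c (suc n) j α∈ β∈)
glue-∈gluingsFrom c zero    j {q} {r} _ sizes _ _ | inj₁ c<q =
  ⊥-elim (<⇒≱ c<q (subst (q ≤_) (trans sizes (+-identityʳ c)) (m≤m+n q r)))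
glue-∈gluingsFrom c (suc n) j _ sizes α∈ β∈ | inj₁ c<q =
  ∈-++⁺ʳ (gluings c (suc n) j) (glue-∈gluingsFrom (suc c) n j c<q (trans sizes (+-suc c n)) α∈ β∈)

-- Gluings with different head sizes are different lists: the head size is the first split.
gluingsFrom-unique : ∀ c n j → Unique (gluingsFrom c n j)
gluingsFrom-unique c zero    j = gluings-unique c 0 j
gluingsFrom-unique c (suc n) j =
  UniqueP.++⁺ (gluings-unique c (suc n) j) (gluingsFrom-unique (suc c) n j) disjoint
  where
    firstSplit-of : ∀ q {α} β → α ∈ PermsWith q 0 → firstSplit 0 0 (glue α q β) ≡ q
    firstSplit-of q β α∈ = let (α-perm , α-free) = ∈PermsWith⇒ q 0 α∈ in firstSplit-glue β α-perm α-free
    disjoint : ∀ {v} → ¬ (v ∈ gluings c (suc n) j × v ∈ gluingsFrom (suc c) n j)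
    disjoint (v∈here , v∈later) with ∈gluings⇒ c (suc n) j v∈here | ∈gluingsFrom⇒ (suc c) n j v∈later
    ... | α , β , α∈ , _ , refl | q , _ , α′ , β′ , c<q , _ , α′∈ , _ , same =
      1+n≰n (subst (suc c ≤_) (trans (sym (firstSplit-of q β′ α′∈)) (trans (cong (firstSplit 0 0) (sym same)) (firstSplit-of c β α∈))) c<q)

St-recurrence : ∀ n j → St (suc n) (suc j) ≡ convolutionFrom (λ q → St q 0) (λ r → St r j) 0 n
St-recurrence n j = begin
  St (suc n) (suc j)                    ≡⟨ St≡length (suc n) (suc j) ⟩
  length (PermsWith (suc n) (suc j))    ≡⟨ same-members⇒same-length (PermsWith-unique (suc n) (suc j))
                                             (gluingsFrom-unique 0 n j) decomposed glued ⟩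
  length (gluingsFrom 0 n j)            ≡⟨ length-gluingsFrom 0 n j ⟩
  convolutionFrom (λ q → St q 0) (λ r → St r j) 0 n ∎
  where
    open ≡-Reasoning
    decomposed : PermsWith (suc n) (suc j) ⊆ gluingsFrom 0 n j
    decomposed l∈ with ∈PermsWith⇒ (suc n) (suc j) l∈
    ... | perm , l-splits with decompose perm l-splits
    ... | q , r , α , β , sizes , α-perm , α-free , β-perm , β-splits , refl =
      glue-∈gluingsFrom 0 n j z≤n sizes (⇒∈PermsWith q 0 α-perm α-free) (⇒∈PermsWith r j β-perm β-splits)
    glued : gluingsFrom 0 n j ⊆ PermsWith (suc n) (suc j)
    glued l∈ with ∈gluingsFrom⇒ 0 n j l∈
    ... | q , r , α , β , _ , sizes , α∈ , β∈ , refl =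
      let (α-perm , α-free) = ∈PermsWith⇒ q 0 α∈
          (β-perm , β-splits) = ∈PermsWith⇒ r j β∈
      in ⇒∈PermsWith (suc n) (suc j) (subst (λ m → IsPermList (suc m) (glue α q β)) sizes (glue-isPermList α-perm β-perm))
                     (trans (glue-splits β α-perm α-free) (cong suc β-splits))

-- Solving the recurrence near the diagonal
--
-- Any array S obeying the convolution recurrence and vanishing below the
-- diagonal is determined near the diagonal by its first column S(q, 0).

module NearDiagonal
  (S : ℕ → ℕ → ℕ)
  (recurrence : ∀ n j → S (suc n) (suc j) ≡ convolutionFrom (λ q → S q 0) (λ r → S r j) 0 n)
  (vanishing  : ∀ n j → n < j → S n j ≡ 0)
  (S₀₀ : S 0 0 ≡ 1) (S₁₀ : S 1 0 ≡ 0) (S₂₀ : S 2 0 ≡ 1) (S₃₀ : S 3 0 ≡ 3) (S₅₀ : S 5 0 ≡ 77)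
  where

  column : ℕ → ℕ → ℕ
  column j n = S n j

  convolution-vanishing : ∀ c n j → n < j → convolutionFrom (column 0) (column j) c n ≡ 0
  convolution-vanishing c zero    j 0<j = trans (cong (S c 0 *_) (vanishing 0 j 0<j)) (*-zeroʳ (S c 0))
  convolution-vanishing c (suc n) j n<j =
    cong₂ _+_ (trans (cong (S c 0 *_) (vanishing (suc n) j n<j)) (*-zeroʳ (S c 0)))
              (convolution-vanishing (suc c) n j (<-trans (n<1+n n) n<j))

  convolution-diagonal : ∀ c k → convolutionFrom (column 0) (column k) c k ≡ S c 0 * S k k
  convolution-diagonal c zero    = refl
  convolution-diagonal c (suc k) =
    trans (cong (S c 0 * S (suc k) (suc k) +_) (convolution-vanishing (suc c) k (suc k) (n<1+n k)))
          (+-identityʳ _)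

  diagonal : ∀ k → S k k ≡ 1
  diagonal zero    = S₀₀
  diagonal (suc k) = begin
    S (suc k) (suc k)  ≡⟨ recurrence k k ⟩
    convolutionFrom (column 0) (column k) 0 k ≡⟨ convolution-diagonal 0 k ⟩
    S 0 0 * S k k      ≡⟨ cong₂ _*_ S₀₀ (diagonal k) ⟩
    1                  ∎
    where open ≡-Reasoning

  convolution-last : ∀ c k → convolutionFrom (column 0) (column k) c k ≡ S c 0
  convolution-last c k = trans (convolution-diagonal c k) (trans (cong (S c 0 *_) (diagonal k)) (*-identityʳ (S c 0)))

  S₁₀-annihilates : ∀ x → S 1 0 * x ≡ 0
  S₁₀-annihilates x = cong (_* x) S₁₀

  above-diagonal₁ : ∀ k → S (1 + k) k ≡ 0
  above-diagonal₁ zero    = S₁₀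
  above-diagonal₁ (suc k) = begin
    S (2 + k) (1 + k)                                  ≡⟨ recurrence (1 + k) k ⟩
    S 0 0 * S (1 + k) k + convolutionFrom (column 0) (column k) 1 k
      ≡⟨ cong₂ _+_ (cong₂ _*_ S₀₀ (above-diagonal₁ k)) (trans (convolution-last 1 k) S₁₀) ⟩
    0                                                  ∎
    where open ≡-Reasoning

  above-diagonal₂ : ∀ k → S (2 + k) k ≡ k + 1
  above-diagonal₂ zero    = S₂₀
  above-diagonal₂ (suc k) = begin
    S (3 + k) (1 + k)                                  ≡⟨ recurrence (2 + k) k ⟩
    S 0 0 * S (2 + k) k + (S 1 0 * S (1 + k) k + convolutionFrom (column 0) (column k) 2 k)
      ≡⟨ cong₂ _+_ (cong₂ _*_ S₀₀ (above-diagonal₂ k))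
                   (cong₂ _+_ (S₁₀-annihilates _) (trans (convolution-last 2 k) S₂₀)) ⟩
    1 * (k + 1) + (0 + 1)                              ≡⟨ arithmetic k ⟩
    suc k + 1                                          ∎
    where
      open ≡-Reasoning
      arithmetic : ∀ k → 1 * (k + 1) + (0 + 1) ≡ suc k + 1
      arithmetic = solve-∀

  above-diagonal₃ : ∀ k → S (3 + k) k ≡ 3 * (k + 1)
  above-diagonal₃ zero    = S₃₀
  above-diagonal₃ (suc k) = begin
    S (4 + k) (1 + k)                                  ≡⟨ recurrence (3 + k) k ⟩
    S 0 0 * S (3 + k) k + (S 1 0 * S (2 + k) k + (S 2 0 * S (1 + k) k + convolutionFrom (column 0) (column k) 3 k))
      ≡⟨ cong₂ _+_ (cong₂ _*_ S₀₀ (above-diagonal₃ k))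
                   (cong₂ _+_ (S₁₀-annihilates _)
                              (cong₂ _+_ (cong₂ _*_ S₂₀ (above-diagonal₁ k)) (trans (convolution-last 3 k) S₃₀))) ⟩
    1 * (3 * (k + 1)) + (0 + (1 * 0 + 3))               ≡⟨ arithmetic k ⟩
    3 * (suc k + 1)                                    ∎
    where
      open ≡-Reasoning
      arithmetic : ∀ k → 1 * (3 * (k + 1)) + (0 + (1 * 0 + 3)) ≡ 3 * (suc k + 1)
      arithmetic = solve-∀

  -- S(k+4, k) only ever meets the factor S(1,0) = 0.
  above-diagonal₅ : ∀ k → S (5 + k) k ≡ (k + 1) * (3 * k + 77)
  above-diagonal₅ zero    = S₅₀
  above-diagonal₅ (suc k) = begin
    S (6 + k) (1 + k)                                  ≡⟨ recurrence (5 + k) k ⟩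
    S 0 0 * S (5 + k) k + (S 1 0 * S (4 + k) k + (S 2 0 * S (3 + k) k + (S 3 0 * S (2 + k) k +
      (S 4 0 * S (1 + k) k + convolutionFrom (column 0) (column k) 5 k))))
      ≡⟨ cong₂ _+_ (cong₂ _*_ S₀₀ (above-diagonal₅ k))
          (cong₂ _+_ (S₁₀-annihilates _)
           (cong₂ _+_ (cong₂ _*_ S₂₀ (above-diagonal₃ k))
            (cong₂ _+_ (cong₂ _*_ S₃₀ (above-diagonal₂ k))
             (cong₂ _+_ (trans (cong (S 4 0 *_) (above-diagonal₁ k)) (*-zeroʳ (S 4 0)))
                        (trans (convolution-last 5 k) S₅₀))))) ⟩
    1 * ((k + 1) * (3 * k + 77)) + (0 + (1 * (3 * (k + 1)) + (3 * (k + 1) + (0 + 77))))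
                                                       ≡⟨ arithmetic k ⟩
    (suc k + 1) * (3 * suc k + 77)                     ∎
    where
      open ≡-Reasoning
      arithmetic : ∀ k → 1 * ((k + 1) * (3 * k + 77)) + (0 + (1 * (3 * (k + 1)) + (3 * (k + 1) + (0 + 77))))
                         ≡ (suc k + 1) * (3 * suc k + 77)
      arithmetic = solve-∀

corollary5 : (k : ℕ) → St (k + 5) k ≡ (k + 1) * (3 * k + 77)
corollary5 k = begin
  St (k + 5) k               ≡⟨ cong (λ n → St n k) (+-comm k 5) ⟩
  St (5 + k) k               ≡⟨ above-diagonal₅ k ⟩
  (k + 1) * (3 * k + 77)     ∎
  where
    open ≡-Reasoning
    -- the first column St(q, 0) for q ≤ 5, by enumeration
    open NearDiagonal St St-recurrence St-vanishing refl refl refl refl refl
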